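{- Let $P\subset V$ be a $d$-dimensional polytope that is $k$-integral with respect to $\mathfrak{e}$ (for some $0\le k\le d$). Then for every positive integer $m$, the dilation $mP=\{mx:x\in P\}$ is $k$-integral with respect to $\mathfrak{e}$.
   Context: $V$ is a real vector space of dimension $D$, $\Lambda\subset V$ a lattice with fixed basis $\mathfrak{e}=(\mathbf{e}^1,\dots,\mathbf{e}^D)$ giving coordinates. $\Lambda_j=\langle\mathbf{e}^1,\dots,\mathbf{e}^j\rangle$; $\pi^{(D-j)}$ forgets the last $D-j$ coordinates. An $r$-dimensional affine subspace $U$ is integral if $\pi^{(D-r)}(U\cap\Lambda)=\Lambda_r$; a polytope is affinely integral if its affine hull is integral; a $d$-dimensional polytope is $k$-integral if all faces of dimension $\le k$ are affinely integral.
   Formalization: The space V is ℚ^D instead of a real vector space, so the polytope P is the convex hull of finitely many points with rational coordinates. -}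

module Defs where

open import Data.Nat using (ℕ; zero; suc)
open import Data.Fin using (Fin; toℕ) renaming (zero to fz; suc to fs)
import Data.Nat as N
open import Data.Integer using (ℤ; +_)
open import Data.Rational using (ℚ; _/_; 0ℚ; 1ℚ; _+_; _*_; _≤_)
open import Data.Product using (Σ; _×_; ∃)
open import Relation.Binary.PropositionalEquality using (_≡_)
open import Relation.Nullary using (¬_)

-- The ambient space V = ℚ^D with the basis 𝔢 the standard basis (coordinates),
-- and the lattice Λ = ℤ^D (points with integer coordinates).
Vect : ℕ → Set
Vect D = Fin D → ℚ

Subset : ℕ → Set₁
Subset D = Vect D → Set

∑ : ∀ {n} → (Fin n → ℚ) → ℚ
∑ {zero} f = 0ℚ
∑ {suc n} f = f fz + ∑ (λ i → f (fs i))

_≈_ : ∀ {D} → Vect D → Vect D → Set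
x ≈ y = ∀ i → x i ≡ y i

lincomb : ∀ {D n} → (Fin n → ℚ) → (Fin n → Vect D) → Vect D
lincomb λ' p j = ∑ (λ i → λ' i * p i j)

_•_ : ∀ {D} → ℚ → Vect D → Vect D
(a • x) j = a * x j

dot : ∀ {D} → Vect D → Vect D → ℚ
dot c x = ∑ (λ j → c j * x j)

Conv : ∀ {D n} → (Fin n → Vect D) → Subset D
Conv {D} {n} v x =
  Σ (Fin n → ℚ) λ λ' → (∀ i → 0ℚ ≤ λ' i) × (∑ λ' ≡ 1ℚ) × (x ≈ lincomb λ' v)

Aff : ∀ {D} → Subset D → Subset D
Aff {D} S x =
  Σ ℕ λ n → Σ (Fin n → Vect D) λ p → (∀ i → S (p i)) ×
    Σ (Fin n → ℚ) λ λ' → (∑ λ' ≡ 1ℚ) × (x ≈ lincomb λ' p)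

AffIndep : ∀ {D n} → (Fin n → Vect D) → Set
AffIndep {D} {n} p =
  (μ : Fin n → ℚ) → ∑ μ ≡ 0ℚ → (∀ j → lincomb μ p j ≡ 0ℚ) → ∀ i → μ i ≡ 0ℚ

AffDim : ∀ {D} → Subset D → ℕ → Set
AffDim {D} U r =
  (Σ (Fin (suc r) → Vect D) λ p → (∀ i → U (p i)) × AffIndep p) ×
  ((q : Fin (suc (suc r)) → Vect D) → (∀ i → U (q i)) → ¬ AffIndep q)

embed : ∀ {D} → (Fin D → ℤ) → Vect D
embed z j = z j / 1

-- an r-dimensional affine subspace U is integral if π^{(D-r)}(U ∩ Λ) = Λ_r,
-- i.e. every integer vector of Λ_r (first r coordinates) is the image of a
-- lattice point of U under forgetting the last D-r coordinates.
-- (The inclusion ⊆ is automatic.)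
Integral : ∀ {D} → Subset D → ℕ → Set
Integral {D} U r =
  (z : Fin D → ℤ) →
    Σ (Fin D → ℤ) λ x → U (embed x) × (∀ i → toℕ i N.< r → x i ≡ z i)

AffinelyIntegral : ∀ {D} → Subset D → Set
AffinelyIntegral S = ∀ r → AffDim (Aff S) r → Integral (Aff S) r

Face : ∀ {D} → Subset D → Vect D → Subset D
Face S c x = S x × (∀ y → S y → dot c y ≤ dot c x)

KIntegral : ∀ {D} → ℕ → Subset D → Set
KIntegral {D} k S =
  (c : Vect D) → ∀ r → AffDim (Aff (Face S c)) r → r N.≤ k →
    AffinelyIntegral (Face S c)

Dilate : ∀ {D} → ℕ → Subset D → Subset D
Dilate m S x = ∃ λ y → S y × (x ≈ ((+ m / 1) • y))

-- The argument never uses that the set is a polytope, so the main result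
-- 'KIntegral-dilate' is proved for an arbitrary subset S of ℚ^D.  Write mS for
-- the dilation.  Three facts about a face F = Face S c combine:
--   (1) faces commute with dilation: Face (mS) c = m·(Face S c), because
--       multiplying by m > 0 preserves the order of the values of ⟨c , -⟩;
--   (2) affine hulls commute with dilation: Aff (mF) = m·(Aff F), hence the
--       affine hull of the face of mS has the same dimension as that of F;
--   (3) if Aff F is integral then so is m·(Aff F): for target coordinates z
--       pick lattice points u ∈ Aff F projecting to 0 and y ∈ Aff F projecting
--       to z; then (m-1)u + y = m·((1 - 1/m)u + (1/m)y) is a lattice point of
--       m·(Aff F) projecting to z.

module Submission where

open import Defs
open import Data.Nat using (ℕ; _≤_; zero; suc)
open import Data.Fin using (Fin; toℕ) renaming (zero to fz; suc to fs)
import Data.Nat as N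
import Data.Nat.Properties as NP
import Data.Nat.Coprimality as Coprimality
import Data.Integer as Z
open import Data.Integer using (ℤ; +_)
import Data.Integer.Properties as ZP
open import Data.Rational using (ℚ; mkℚ; _/_; 0ℚ; 1ℚ; _+_; _*_; _-_; 1/_)
  renaming (_≤_ to _≤q_)
import Data.Rational.Properties as QP
open import Data.Rational.Solver using (module +-*-Solver)
open import Data.Product using (_×_; _,_; proj₁; proj₂)
open import Relation.Binary.PropositionalEquality
open import Relation.Nullary using (¬_)
open +-*-Solver

_⊆_ : ∀ {D} → Subset D → Subset D → Set
S ⊆ T = ∀ x → S x → T x

∑-cong : ∀ {n} {f g : Fin n → ℚ} → (∀ i → f i ≡ g i) → ∑ f ≡ ∑ g
∑-cong {zero} h = refl
∑-cong {suc n} h = cong₂ _+_ (h fz) (∑-cong (λ i → h (fs i)))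

∑-scale : ∀ {n} (s : ℚ) {f g : Fin n → ℚ} → (∀ i → f i ≡ s * g i) → ∑ f ≡ s * ∑ g
∑-scale {zero} s h = sym (QP.*-zeroʳ s)
∑-scale {suc n} s h =
  trans (cong₂ _+_ (h fz) (∑-scale s (λ i → h (fs i)))) (sym (QP.*-distribˡ-+ s _ _))

*-swapˡ : ∀ a s b → a * (s * b) ≡ s * (a * b)
*-swapˡ = solve 3 (λ a s b → a :* (s :* b) := s :* (a :* b)) refl

lincomb-scale : ∀ {D n} (s : ℚ) (μ : Fin n → ℚ) (p q : Fin n → Vect D) →
  (∀ i j → p i j ≡ s * q i j) → ∀ j → lincomb μ p j ≡ s * lincomb μ q j
lincomb-scale s μ p q h j =
  ∑-scale s (λ i → trans (cong (μ i *_) (h i j)) (*-swapˡ (μ i) s (q i j)))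

dot-scale : ∀ {D} (s : ℚ) (c x y : Vect D) →
  (∀ j → x j ≡ s * y j) → dot c x ≡ s * dot c y
dot-scale s c x y h =
  ∑-scale s (λ j → trans (cong (c j *_) (h j)) (*-swapˡ (c j) s (y j)))

lincomb-scaleʷ : ∀ {D n} (s : ℚ) (μ : Fin n → ℚ) (p : Fin n → Vect D) →
  ∀ j → lincomb (λ i → s * μ i) p j ≡ s * lincomb μ p j
lincomb-scaleʷ s μ p j = ∑-scale s (λ i → QP.*-assoc s (μ i) (p i j))

_++ᶠ_ : ∀ {A : Set} {n₁ n₂} → (Fin n₁ → A) → (Fin n₂ → A) → Fin (n₁ N.+ n₂) → A
_++ᶠ_ {n₁ = zero} f g i = g i
_++ᶠ_ {n₁ = suc n} f g fz = f fz
_++ᶠ_ {n₁ = suc n} f g (fs i) = ((λ k → f (fs k)) ++ᶠ g) i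

++ᶠ-all : ∀ {A : Set} {n₁ n₂} (P : A → Set) (f : Fin n₁ → A) (g : Fin n₂ → A) →
  (∀ i → P (f i)) → (∀ i → P (g i)) → ∀ i → P ((f ++ᶠ g) i)
++ᶠ-all {n₁ = zero} P f g hf hg i = hg i
++ᶠ-all {n₁ = suc n} P f g hf hg fz = hf fz
++ᶠ-all {n₁ = suc n} P f g hf hg (fs i) =
  ++ᶠ-all P (λ k → f (fs k)) g (λ k → hf (fs k)) hg i

∑-++ᶠ : ∀ {n₁ n₂} (f : Fin n₁ → ℚ) (g : Fin n₂ → ℚ) → ∑ (f ++ᶠ g) ≡ ∑ f + ∑ g
∑-++ᶠ {zero} f g = sym (QP.+-identityˡ (∑ g))
∑-++ᶠ {suc n} f g =
  trans (cong (λ e → f fz + e) (∑-++ᶠ (λ k → f (fs k)) g)) (sym (QP.+-assoc (f fz) _ _))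

lincomb-++ᶠ : ∀ {D n₁ n₂} (λ₁ : Fin n₁ → ℚ) (λ₂ : Fin n₂ → ℚ)
  (p : Fin n₁ → Vect D) (q : Fin n₂ → Vect D) →
  ∀ j → lincomb (λ₁ ++ᶠ λ₂) (p ++ᶠ q) j ≡ lincomb λ₁ p j + lincomb λ₂ q j
lincomb-++ᶠ {n₁ = zero} λ₁ λ₂ p q j = sym (QP.+-identityˡ _)
lincomb-++ᶠ {n₁ = suc n} λ₁ λ₂ p q j =
  trans (cong (λ e → λ₁ fz * p fz j + e)
              (lincomb-++ᶠ (λ k → λ₁ (fs k)) λ₂ (λ k → p (fs k)) q j))
        (sym (QP.+-assoc (λ₁ fz * p fz j) _ (lincomb λ₂ q j)))

Aff-mono : ∀ {D} {S T : Subset D} → S ⊆ T → Aff S ⊆ Aff T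
Aff-mono S⊆T x (n , p , hp , l , sl , e) = n , p , (λ i → S⊆T (p i) (hp i)) , l , sl , e

Aff-comb : ∀ {D} {S : Subset D} (α β : ℚ) → α + β ≡ 1ℚ → {a b : Vect D} →
  Aff S a → Aff S b → Aff S (λ j → α * a j + β * b j)
Aff-comb {S = S} α β α+β≡1 {a} {b}
  (n₁ , p , hp , L , ∑L≡1 , a≈Lp) (n₂ , q , hq , M , ∑M≡1 , b≈Mq) =
  n₁ N.+ n₂ , p ++ᶠ q , ++ᶠ-all S p q hp hq , weights , weights-sum , point
  where
  weights = (λ i → α * L i) ++ᶠ (λ i → β * M i)

  scaled-sum : ∀ {n} (s : ℚ) (μ : Fin n → ℚ) → ∑ μ ≡ 1ℚ → ∑ (λ i → s * μ i) ≡ s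
  scaled-sum s μ ∑μ≡1 =
    trans (∑-scale s {g = μ} (λ i → refl)) (trans (cong (s *_) ∑μ≡1) (QP.*-identityʳ s))

  weights-sum : ∑ weights ≡ 1ℚ
  weights-sum = trans (∑-++ᶠ (λ i → α * L i) (λ i → β * M i))
    (trans (cong₂ _+_ (scaled-sum α L ∑L≡1) (scaled-sum β M ∑M≡1)) α+β≡1)

  point : ∀ j → α * a j + β * b j ≡ lincomb weights (p ++ᶠ q) j
  point j = begin
    α * a j + β * b j
      ≡⟨ cong₂ (λ u v → α * u + β * v) (a≈Lp j) (b≈Mq j) ⟩
    α * lincomb L p j + β * lincomb M q j
      ≡⟨ sym (cong₂ _+_ (lincomb-scaleʷ α L p j) (lincomb-scaleʷ β M q j)) ⟩
    lincomb (λ i → α * L i) p j + lincomb (λ i → β * M i) q j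
      ≡⟨ sym (lincomb-++ᶠ _ _ p q j) ⟩
    lincomb weights (p ++ᶠ q) j ∎
    where open ≡-Reasoning

/1-normal : ∀ a → a / 1 ≡ mkℚ a 0 (Coprimality.sym (Coprimality.1-coprimeTo _))
/1-normal a = QP.↥p/↧p≡p (mkℚ a 0 (Coprimality.sym (Coprimality.1-coprimeTo _)))

/1-+ : ∀ a b → (a Z.+ b) / 1 ≡ (a / 1) + (b / 1)
/1-+ a b rewrite /1-normal a | /1-normal b =
  cong (_/ 1) (cong₂ Z._+_ (sym (ZP.*-identityʳ a)) (sym (ZP.*-identityʳ b)))

/1-* : ∀ a b → (a Z.* b) / 1 ≡ (a / 1) * (b / 1)
/1-* a b rewrite /1-normal a | /1-normal b = refl

AffDim-transport : ∀ {D} {U W : Subset D} {r} → U ⊆ W → W ⊆ U → AffDim U r → AffDim W r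
AffDim-transport U⊆W W⊆U ((p , hp , indep) , maximal) =
  (p , (λ i → U⊆W (p i) (hp i)) , indep) ,
  (λ q hq → maximal q (λ i → W⊆U (q i) (hq i)))

Integral-mono : ∀ {D} {U W : Subset D} {r} → U ⊆ W → Integral U r → Integral W r
Integral-mono U⊆W I z = proj₁ (I z) , U⊆W _ (proj₁ (proj₂ (I z))) , proj₂ (proj₂ (I z))

-- If s = a + 1 and s·t = 1 then s·((1 - t)u + t y) = a u + y.  This is the
-- identity behind step (3): (m-1)u + y is m times an affine combination.
affine-rescale : ∀ a t u y → (a + 1ℚ) * t ≡ 1ℚ →
  (a + 1ℚ) * ((1ℚ - t) * u + t * y) ≡ a * u + y
affine-rescale a t u y st≡1 = begin
  (a + 1ℚ) * ((1ℚ - t) * u + t * y)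
    ≡⟨ solve 4 (λ a t u y → (a :+ con 1ℚ) :* ((con 1ℚ :- t) :* u :+ t :* y)
                 := (a :+ con 1ℚ) :* u :- ((a :+ con 1ℚ) :* t) :* u
                    :+ ((a :+ con 1ℚ) :* t) :* y) refl a t u y ⟩
  (a + 1ℚ) * u - ((a + 1ℚ) * t) * u + ((a + 1ℚ) * t) * y
    ≡⟨ cong (λ e → (a + 1ℚ) * u - e * u + e * y) st≡1 ⟩
  (a + 1ℚ) * u - 1ℚ * u + 1ℚ * y
    ≡⟨ solve 3 (λ a u y → (a :+ con 1ℚ) :* u :- con 1ℚ :* u :+ con 1ℚ :* y
                 := a :* u :+ y) refl a u y ⟩
  a * u + y ∎
  where open ≡-Reasoning

module Dilation (m' : ℕ) where

  m : ℕ
  m = suc m'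

  s : ℚ
  s = + m / 1

  -- s in normal form, which carries the instances Positive and NonZero
  ŝ : ℚ
  ŝ = mkℚ (+ m) 0 (Coprimality.sym (Coprimality.1-coprimeTo _))

  s≡ŝ : s ≡ ŝ
  s≡ŝ = /1-normal (+ m)

  s≡m'+1 : s ≡ (+ m') / 1 + 1ℚ
  s≡m'+1 = trans (cong (λ k → + k / 1) (NP.+-comm 1 m')) (/1-+ (+ m') (+ 1))

  t : ℚ
  t = 1/ ŝ

  s*t≡1 : s * t ≡ 1ℚ
  s*t≡1 = subst (λ r → r * t ≡ 1ℚ) (sym s≡ŝ) (QP.*-inverseʳ ŝ)

  [m'+1]*t≡1 : ((+ m') / 1 + 1ℚ) * t ≡ 1ℚ
  [m'+1]*t≡1 = subst (λ r → r * t ≡ 1ℚ) s≡m'+1 s*t≡1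

  s-mono : ∀ {a b} → a ≤q b → s * a ≤q s * b
  s-mono {a} {b} a≤b =
    subst (λ r → r * a ≤q r * b) (sym s≡ŝ) (QP.*-monoˡ-≤-nonNeg ŝ a≤b)

  s-cancel : ∀ {a b} → s * a ≤q s * b → a ≤q b
  s-cancel {a} {b} sa≤sb = QP.*-cancelˡ-≤-pos ŝ (subst (λ r → r * a ≤q r * b) s≡ŝ sa≤sb)

  s-cancel-zero : ∀ a → s * a ≡ 0ℚ → a ≡ 0ℚ
  s-cancel-zero a sa≡0 = begin
    a              ≡⟨ sym (QP.*-identityˡ a) ⟩
    1ℚ * a         ≡⟨ cong (_* a) (sym (trans (QP.*-comm t s) s*t≡1)) ⟩
    (t * s) * a    ≡⟨ QP.*-assoc t s a ⟩
    t * (s * a)    ≡⟨ cong (t *_) sa≡0 ⟩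
    t * 0ℚ         ≡⟨ QP.*-zeroʳ t ⟩
    0ℚ ∎
    where open ≡-Reasoning

  module _ {D} (S : Subset D) (c : Vect D) where

    Face-dilate⊆ : Face (Dilate m S) c ⊆ Dilate m (Face S c)
    Face-dilate⊆ x ((y , Sy , x≈sy) , x-max) = y , (Sy , y-max) , x≈sy
      where
      y-max : ∀ w → S w → dot c w ≤q dot c y
      y-max w Sw = s-cancel (subst₂ _≤q_ (dot-scale s c (s • w) w (λ j → refl))
                                         (dot-scale s c x y x≈sy)
                                         (x-max (s • w) (w , Sw , λ j → refl)))

    Face-dilate⊇ : Dilate m (Face S c) ⊆ Face (Dilate m S) c
    Face-dilate⊇ x (y , (Sy , y-max) , x≈sy) = (y , Sy , x≈sy) , x-max
      where
      x-max : ∀ w' → Dilate m S w' → dot c w' ≤q dot c x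
      x-max w' (w , Sw , w'≈sw) = subst₂ _≤q_ (sym (dot-scale s c w' w w'≈sw))
                                              (sym (dot-scale s c x y x≈sy))
                                              (s-mono (y-max w Sw))

  module _ {D} (F : Subset D) where

    Aff-dilate⊆ : Aff (Dilate m F) ⊆ Dilate m (Aff F)
    Aff-dilate⊆ x (n , p , hp , l , ∑l≡1 , x≈lp) =
      lincomb l q , (n , q , (λ i → proj₁ (proj₂ (hp i))) , l , ∑l≡1 , (λ j → refl)) ,
      (λ j → trans (x≈lp j) (lincomb-scale s l p q (λ i → proj₂ (proj₂ (hp i))) j))
      where
      q : Fin n → Vect D
      q i = proj₁ (hp i)

    Aff-dilate⊇ : Dilate m (Aff F) ⊆ Aff (Dilate m F)
    Aff-dilate⊇ x (y , (n , q , hq , l , ∑l≡1 , y≈lq) , x≈sy) =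
      n , (λ i → s • q i) , (λ i → q i , hq i , (λ j → refl)) , l , ∑l≡1 ,
      (λ j → trans (x≈sy j) (trans (cong (s *_) (y≈lq j))
               (sym (lincomb-scale s l (λ i → s • q i) q (λ i j → refl) j))))

    AffDim-undilate : ∀ {r} → AffDim (Dilate m F) r → AffDim F r
    AffDim-undilate ((p , hp , indep) , maximal) =
      (p' , (λ i → proj₁ (proj₂ (hp i))) , indep') , maximal'
      where
      p' : _ → Vect D
      p' i = proj₁ (hp i)

      indep' : AffIndep p'
      indep' μ ∑μ≡0 μp'≡0 =
        indep μ ∑μ≡0 (λ j → trans (lincomb-scale s μ p p' (λ i → proj₂ (proj₂ (hp i))) j)
                                  (trans (cong (s *_) (μp'≡0 j)) (QP.*-zeroʳ s)))

      maximal' : (q : _ → Vect D) → (∀ i → F (q i)) → ¬ AffIndep q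
      maximal' q hq indep-q = maximal (λ i → s • q i) (λ i → q i , hq i , (λ j → refl))
        (λ μ ∑μ≡0 μsq≡0 → indep-q μ ∑μ≡0 (λ j → s-cancel-zero _
          (trans (sym (lincomb-scale s μ (λ i → s • q i) q (λ i j → refl) j)) (μsq≡0 j))))

    Integral-dilate : ∀ {r} → Integral (Aff F) r → Integral (Dilate m (Aff F)) r
    Integral-dilate {r} I z = X , (w , w∈AffF , X≈sw) , X-proj
      where
      u = proj₁ (I (λ _ → + 0))
      y = proj₁ (I z)

      X : Fin D → ℤ
      X j = + m' Z.* u j Z.+ y j

      w : Vect D
      w j = (1ℚ - t) * embed u j + t * embed y j

      w∈AffF : Aff F w
      w∈AffF = Aff-comb {S = F} (1ℚ - t) t (solve 1 (λ t → (con 1ℚ :- t) :+ t := con 1ℚ) refl t)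
                        (proj₁ (proj₂ (I (λ _ → + 0)))) (proj₁ (proj₂ (I z)))

      X≈sw : ∀ j → embed X j ≡ s * w j
      X≈sw j = begin
        embed X j
          ≡⟨ /1-+ (+ m' Z.* u j) (y j) ⟩
        (+ m' Z.* u j) / 1 + embed y j
          ≡⟨ cong (_+ embed y j) (/1-* (+ m') (u j)) ⟩
        (+ m' / 1) * embed u j + embed y j
          ≡⟨ sym (affine-rescale (+ m' / 1) t (embed u j) (embed y j) [m'+1]*t≡1) ⟩
        ((+ m' / 1) + 1ℚ) * w j
          ≡⟨ cong (_* w j) (sym s≡m'+1) ⟩
        s * w j ∎
        where open ≡-Reasoning

      X-proj : ∀ i → toℕ i N.< r → X i ≡ z i
      X-proj i i<r = trans
        (cong₂ Z._+_ (trans (cong (+ m' Z.*_) (proj₂ (proj₂ (I (λ _ → + 0))) i i<r))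
                            (ZP.*-zeroʳ (+ m')))
                     (proj₂ (proj₂ (I z)) i i<r))
        (ZP.+-identityˡ (z i))

  module _ {D} (S : Subset D) (c : Vect D) where

    Aff-Face-dilate⊆ : Aff (Face (Dilate m S) c) ⊆ Dilate m (Aff (Face S c))
    Aff-Face-dilate⊆ x h = Aff-dilate⊆ (Face S c) x (Aff-mono (Face-dilate⊆ S c) x h)

    Aff-Face-dilate⊇ : Dilate m (Aff (Face S c)) ⊆ Aff (Face (Dilate m S) c)
    Aff-Face-dilate⊇ x h = Aff-mono (Face-dilate⊇ S c) x (Aff-dilate⊇ (Face S c) x h)

    AffDim-Face-undilate : ∀ {r} →
      AffDim (Aff (Face (Dilate m S) c)) r → AffDim (Aff (Face S c)) r
    AffDim-Face-undilate h =
      AffDim-undilate (Aff (Face S c)) (AffDim-transport Aff-Face-dilate⊆ Aff-Face-dilate⊇ h)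

  KIntegral-dilate : ∀ {D} k (S : Subset D) → KIntegral k S → KIntegral k (Dilate m S)
  KIntegral-dilate k S S-kint c r dim r≤k r' dim' =
    Integral-mono (Aff-Face-dilate⊇ S c)
      (Integral-dilate (Face S c)
        (S-kint c r (AffDim-Face-undilate S c dim) r≤k r' (AffDim-Face-undilate S c dim')))

lemma3p12 : (D d k n : ℕ) (v : Fin n → Vect D) →
    AffDim (Aff (Conv v)) d → k ≤ d → KIntegral k (Conv v) →
    (m : ℕ) → 1 ≤ m → KIntegral k (Dilate m (Conv v))
lemma3p12 D d k n v _ _ P-kint (suc m') _ = Dilation.KIntegral-dilate m' k (Conv v) P-kint
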